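{- Let $K$ be a spanning tree on $n$ vertices, and let $\mathcal S=\{S_i:1\le i\le n-1\}$ be a family of subsets of the vertex set of $K$ with $|S_i|=i$ and $S_i\subsetneq S_{i+1}$. Then there exists a bijection from $\mathcal S$ to the edge set $E(K)$ mapping each $S_i$ to an edge of $K$ in $\delta(S_i)$.
   Context: $\delta(S)$ denotes the set of edges with exactly one endpoint in $S$. -}

module Defs where

open import Data.Nat using (ℕ; zero; suc; _≤_; _∸_)
open import Data.Bool using (Bool; true)
open import Data.Fin using (Fin; toℕ; _<_)
open import Data.Fin.Subset using (Subset; _∈_; _∉_)
open import Data.List using (List; []; _∷_; _++_; [_]; length)
open import Data.List.Relation.Unary.Linked using (Linked)
open import Data.List.Relation.Unary.Unique.Propositional using (Unique)
open import Data.Product using (Σ; _×_; _,_; ∃-syntax)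
open import Data.Sum using (_⊎_)
open import Relation.Binary.PropositionalEquality using (_≡_)
open import Relation.Nullary using (¬_)

record SimpleGraph (n : ℕ) : Set where
  field
    adj    : Fin n → Fin n → Bool
    sym    : ∀ u v → adj u v ≡ adj v u
    irrefl : ∀ u → ¬ (adj u u ≡ true)

module _ {n : ℕ} (G : SimpleGraph n) where
  open SimpleGraph G

  Adj : Fin n → Fin n → Set
  Adj u v = adj u v ≡ true

  -- The edge set E(G): each edge {u,v} is represented once, with u < v.
  Edge : Set
  Edge = Σ (Fin n × Fin n) λ { (u , v) → (u < v) × Adj u v }

  data Walk : Fin n → Fin n → Set where
    here : ∀ {u} → Walk u u
    step : ∀ {u w v} → Adj u w → Walk w v → Walk u v

  Connected : Set
  Connected = ∀ u v → Walk u v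

  HasCycle : Set
  HasCycle = ∃[ x ] ∃[ xs ] (2 ≤ length xs × Unique (x ∷ xs)
                              × Linked Adj ((x ∷ xs) ++ [ x ]))

  -- A tree: connected and acyclic.  (A spanning tree on n vertices is a
  -- tree whose vertex set is all of Fin n.)
  IsTree : Set
  IsTree = Connected × ¬ HasCycle

InDelta : ∀ {n} (G : SimpleGraph n) → Subset n → Edge G → Set
InDelta G S ((u , v) , _) = (u ∈ S × v ∉ S) ⊎ (u ∉ S × v ∈ S)

-- Let rank v + 1 be the least i with v ∈ Sᵢ, where Sₙ is the whole vertex set.  As |Sᵢ| = i,
-- the ranks are distinct and Sᵢ consists of the i vertices of smallest rank, so an edge lies in
-- δ(Sᵢ) exactly when one end has rank below i and the other does not.  Grow K from one vertex by
-- attaching leaves; every edge of K gets attached, since an edge closing up a tree path would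
-- form a cycle.  Then match cuts with edges by induction along the growth: remove the last
-- attached leaf x with neighbour y, close up the gap x leaves in the ranking, match the smaller
-- tree, and give the edge xy the cut between x and the next vertex of the ranking on y's side.
module Submission where

open import Defs
open import Axiom.UniquenessOfIdentityProofs using (module Decidable⇒UIP)
import Data.Bool as Bool
open import Data.Empty using (⊥-elim)
open import Data.Fin
  using (Fin; zero; suc; toℕ; inject₁; fromℕ<; punchIn; punchOut; pinch; _≤_; _≟_)
open import Data.Fin.Induction using (<-weakInduction-startingFrom)
open import Data.Fin.Properties
  using ( toℕ-inject₁; toℕ-fromℕ<; toℕ<n; suc-injective; injective⇒≤
        ; <-irrelevant; <-irrefl; <-asym; <-cmp
        ; punchInᵢ≢i; punchIn-punchOut; punchOut-punchIn; punchOut-cong; punchOut-injective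
        ; pinch-injective )
open import Data.Fin.Subset
  using (Subset; ⊥; ⊤; ⁅_⁆; _∪_; _⊂_; ∣_∣)
  renaming (_∈_ to _∈ₛ_; _∉_ to _∉ₛ_; _⊆_ to _⊆ₛ_)
open import Data.Fin.Subset.Properties
  using ( ∉⊥; ∈⊤; ∣⊥∣≡0; ∣⊤∣≡n; x∈⁅x⁆; x∈⁅y⁆⇒x≡y; p⊆p∪q; x∈p∪q⁺; x∈p∪q⁻; p⊂q⇒∣p∣<∣q∣ )
  renaming (_∈?_ to _∈ₛ?_)
open import Data.List using (List; []; _∷_; [_]; length; last; _∷ʳ_; allFin; lookup)
open import Data.List.Membership.Propositional using (_∈_; _∉_)
open import Data.List.Membership.Propositional.Properties using (∈-allFin; ∈-lookup)
open import Data.List.Relation.Binary.Subset.Propositional using (_⊆_)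
open import Data.List.Relation.Unary.All as All using (All; []; _∷_)
open import Data.List.Relation.Unary.All.Properties using (¬Any⇒All¬; ∷ʳ⁺)
open import Data.List.Relation.Unary.AllPairs using ([]; _∷_)
open import Data.List.Relation.Unary.Any as Any using (here; there)
open import Data.List.Relation.Unary.Any.Properties using (lookup-index)
open import Data.List.Relation.Unary.Linked using (Linked; [-]; _∷_)
import Data.List.Relation.Unary.Linked.Properties as Linked
open import Data.List.Relation.Unary.Unique.Propositional using (Unique)
import Data.List.Relation.Unary.Unique.Propositional.Properties as Unique
open import Data.Maybe using (just)
import Data.Maybe.Relation.Binary.Connected as Maybe
open import Data.Nat as ℕ using (ℕ; zero; suc; _∸_; z≤n; s≤s; s≤s⁻¹; _<?_)
import Data.Nat.Properties as ℕ
open import Data.Product as Product using (Σ-syntax; _×_; _,_; proj₁; proj₂; ∃; ∃₂; ∃-syntax)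
open import Data.Sum as Sum using (_⊎_; inj₁; inj₂; [_,_]′)
open import Function using (_∘_; id; _⇔_; mk⇔; Injective; Bijective)
open import Function.Bundles using (module Equivalence)
open import Function.Consequences.Propositional using (strictlySurjective⇒surjective)
open import Function.Construct.Composition using (_⇔-∘_)
open import Function.Construct.Symmetry using (⇔-sym)
open import Relation.Binary.Definitions using (tri<; tri≈; tri>)
open import Relation.Binary.PropositionalEquality
  using (_≡_; _≢_; refl; sym; trans; cong; subst; subst₂)
open import Relation.Nullary using (¬_; yes; no; contradiction)
open import Relation.Unary using (Pred; Decidable)

ExactlyOne : Set → Set → Set
ExactlyOne A B = (A × ¬ B) ⊎ (¬ A × B)

ExactlyOne-sym : ∀ {A B} → ExactlyOne A B → ExactlyOne B A
ExactlyOne-sym (inj₁ (a , ¬b)) = inj₂ (¬b , a)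
ExactlyOne-sym (inj₂ (¬a , b)) = inj₁ (b , ¬a)

ExactlyOne-resp : ∀ {A A′ B B′} → A ⇔ A′ → B ⇔ B′ → ExactlyOne A B → ExactlyOne A′ B′
ExactlyOne-resp A⇔A′ B⇔B′ (inj₁ (a , ¬b)) =
  inj₁ (Equivalence.to A⇔A′ a , ¬b ∘ Equivalence.from B⇔B′)
ExactlyOne-resp A⇔A′ B⇔B′ (inj₂ (¬a , b)) =
  inj₂ (¬a ∘ Equivalence.from A⇔A′ , Equivalence.to B⇔B′ b)

s≤s⇔ : ∀ {a b} → a ℕ.≤ b ⇔ suc a ℕ.≤ suc b
s≤s⇔ = mk⇔ s≤s s≤s⁻¹

pinch≤⇔≤punchIn : ∀ {k} (q : Fin (suc k)) (a : Fin (suc (suc k))) (j : Fin k) →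
                  pinch q a ≤ j ⇔ a ≤ punchIn q j
pinch≤⇔≤punchIn zero    zero    j       = mk⇔ (λ _ → z≤n) (λ _ → z≤n)
pinch≤⇔≤punchIn zero    (suc a) j       = s≤s⇔
pinch≤⇔≤punchIn (suc q) zero    j       = mk⇔ (λ _ → z≤n) (λ _ → z≤n)
pinch≤⇔≤punchIn (suc q) (suc a) zero    = mk⇔ (λ ()) (λ ())
pinch≤⇔≤punchIn (suc q) (suc a) (suc j) = s≤s⇔ ⇔-∘ (pinch≤⇔≤punchIn q a j ⇔-∘ ⇔-sym s≤s⇔)

pinch-injective′ : ∀ {k} {i : Fin k} {a b : Fin (suc k)} →
                   inject₁ i ≢ a → inject₁ i ≢ b → pinch i a ≡ pinch i b → a ≡ b
pinch-injective′ {i = zero}  {zero}          i≢0 _   _  = contradiction refl i≢0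
pinch-injective′ {i = zero}  {suc a} {zero}  _   i≢0 _  = contradiction refl i≢0
pinch-injective′ {i = zero}  {suc a} {suc b} _   _   eq = cong suc eq
pinch-injective′ {i = suc i} {zero}  {zero}  _   _   _  = refl
pinch-injective′ {i = suc i} {suc a} {suc b} i≢a i≢b eq =
  cong suc (pinch-injective′ (i≢a ∘ cong suc) (i≢b ∘ cong suc) (suc-injective eq))

pinch-injective-avoiding : ∀ {k} {i : Fin k} {p a b : Fin (suc k)} → p ≡ inject₁ i ⊎ p ≡ suc i →
                           p ≢ a → p ≢ b → pinch i a ≡ pinch i b → a ≡ b
pinch-injective-avoiding (inj₁ refl) = pinch-injective′
pinch-injective-avoiding (inj₂ refl) = pinch-injective

cutNextTo : ∀ {k} (p r : Fin (suc (suc k))) → p ≢ r →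
            Σ[ q ∈ Fin (suc k) ] (p ≡ inject₁ q ⊎ p ≡ suc q) × ExactlyOne (p ≤ q) (r ≤ q)
cutNextTo zero    zero    p≢r = contradiction refl p≢r
cutNextTo zero    (suc r) _   = zero , inj₁ refl , inj₁ (z≤n , λ ())
cutNextTo (suc p) zero    _   = p , inj₂ refl , inj₂ (ℕ.1+n≰n , z≤n)
cutNextTo {zero}  (suc zero) (suc zero) p≢r = contradiction refl p≢r
cutNextTo {suc k} (suc p)    (suc r)    p≢r with cutNextTo p r (p≢r ∘ cong suc)
... | q , side , p|r = suc q , Sum.map (cong suc) (cong suc) side , ExactlyOne-resp s≤s⇔ s≤s⇔ p|r

module _ {a} {A : Set a} where

  last-∷ʳ : ∀ (xs : List A) x → last (xs ∷ʳ x) ≡ just x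
  last-∷ʳ []           x = refl
  last-∷ʳ (y ∷ [])     x = refl
  last-∷ʳ (y ∷ z ∷ zs) x = last-∷ʳ (z ∷ zs) x

  linked-∷ʳ : ∀ {r} {R : A → A → Set r} {xs y x} → Linked R xs → last xs ≡ just y → R y x →
              Linked R (xs ∷ʳ x)
  linked-∷ʳ {R = R} {x = x} Rxs last≡y Ryx =
    Linked.++⁺ Rxs (subst (λ l → Maybe.Connected R l (just x)) (sym last≡y) (Maybe.just Ryx)) [-]

  unique-∷ʳ : ∀ {xs : List A} {x} → Unique xs → x ∉ xs → Unique (xs ∷ʳ x)
  unique-∷ʳ xs! x∉xs = Unique.++⁺ xs! ([] ∷ []) λ { (x∈xs , here refl) → x∉xs x∈xs }

  ∉-within : ∀ {V xs} {x : A} → x ∉ V → All (_∈ V) xs → x ∉ xs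
  ∉-within x∉V xs⊆V = x∉V ∘ All.lookup xs⊆V

  lookup-injective : ∀ {xs : List A} → Unique xs → Injective _≡_ _≡_ (lookup xs)
  lookup-injective (_  ∷ _) {zero}  {zero}  _  = refl
  lookup-injective (x≢ ∷ _) {zero}  {suc j} eq = contradiction eq (All.lookup x≢ (∈-lookup j))
  lookup-injective (x≢ ∷ _) {suc i} {zero}  eq = contradiction (sym eq) (All.lookup x≢ (∈-lookup i))
  lookup-injective {_ ∷ _ ∷ _} (_ ∷ xs!) {suc i} {suc j} eq = cong suc (lookup-injective xs! eq)

enumeration-length : ∀ {n} {xs : List (Fin n)} → Unique xs → (∀ x → x ∈ xs) → length xs ≡ n
enumeration-length {xs = xs} xs! all∈ =
  ℕ.≤-antisym (injective⇒≤ (lookup-injective xs!)) (injective⇒≤ index-injective)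
  where
  index-injective : Injective _≡_ _≡_ (λ x → Any.index (all∈ x))
  index-injective {u} {v} eq =
    trans (lookup-index (all∈ u)) (trans (cong (lookup xs) eq) (sym (lookup-index (all∈ v))))

-- Ranking the vertices by a chain of subsets

firstIndex : ∀ {m ℓ} {P : Pred (Fin m) ℓ} → Decidable P → Fin (suc m)
firstIndex {zero}  P? = zero
firstIndex {suc m} P? with P? zero
... | yes _ = zero
... | no  _ = suc (firstIndex (P? ∘ suc))

firstIndex≤⇔ : ∀ {m ℓ} {P : Pred (Fin m) ℓ} (P? : Decidable P) →
               (∀ {i j} → i ≤ j → P i → P j) → ∀ k → P k ⇔ firstIndex P? ≤ k
firstIndex≤⇔ {suc m} P? up k with P? zero
... | yes P0 = mk⇔ (λ _ → z≤n) (λ _ → up z≤n P0)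
firstIndex≤⇔ {suc m} P? up zero    | no ¬P0 = mk⇔ (λ P0 → contradiction P0 ¬P0) (λ ())
firstIndex≤⇔ {suc m} P? up (suc k) | no ¬P0 = s≤s⇔ ⇔-∘ firstIndex≤⇔ (P? ∘ suc) (up ∘ s≤s) k

2+∣p∣≤∣q∣ : ∀ {n} {p q : Subset n} {x y} → p ⊆ₛ q → x ∈ₛ q → y ∈ₛ q → x ∉ₛ p → y ∉ₛ p → x ≢ y →
           2 ℕ.+ ∣ p ∣ ℕ.≤ ∣ q ∣
2+∣p∣≤∣q∣ {p = p} {q} {x} {y} p⊆q x∈q y∈q x∉p y∉p x≢y =
  ℕ.<-≤-trans (s≤s (p⊂q⇒∣p∣<∣q∣ p⊂p∪x)) (p⊂q⇒∣p∣<∣q∣ p∪x⊂q)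
  where
  p⊂p∪x : p ⊂ p ∪ ⁅ x ⁆
  p⊂p∪x = p⊆p∪q ⁅ x ⁆ , x , x∈p∪q⁺ (inj₂ (x∈⁅x⁆ x)) , x∉p
  p∪x⊂q : p ∪ ⁅ x ⁆ ⊂ q
  p∪x⊂q = [ p⊆q , (λ z∈x → subst (_∈ₛ q) (sym (x∈⁅y⁆⇒x≡y x z∈x)) x∈q) ]′ ∘ x∈p∪q⁻ p ⁅ x ⁆
        , y , y∈q , [ y∉p , (λ y∈x → x≢y (sym (x∈⁅y⁆⇒x≡y x y∈x))) ]′ ∘ x∈p∪q⁻ p ⁅ x ⁆

chain-mono : ∀ {m n} {S : Fin m → Subset n} → (∀ k l → toℕ l ≡ suc (toℕ k) → S k ⊆ₛ S l) →
             ∀ {k l} → k ≤ l → S k ⊆ₛ S l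
chain-mono {suc m} {S = S} S⊆S {k} =
  <-weakInduction-startingFrom (λ l → S k ⊆ₛ S l) id
    (λ j k⊆j → S⊆S (inject₁ j) (suc j) (cong suc (sym (toℕ-inject₁ j))) ∘ k⊆j)

module Chain {m : ℕ} (S : Fin m → Subset (suc m)) (∣S∣ : ∀ k → ∣ S k ∣ ≡ suc (toℕ k))
             (S⊆S : ∀ k l → toℕ l ≡ suc (toℕ k) → S k ⊆ₛ S l) where

  rank : Fin (suc m) → Fin (suc m)
  rank v = firstIndex (λ k → v ∈ₛ? S k)

  ∈⇔rank≤ : ∀ {v} k → v ∈ₛ S k ⇔ rank v ≤ k
  ∈⇔rank≤ {v} = firstIndex≤⇔ (λ k → v ∈ₛ? S k) (λ k≤l → chain-mono S⊆S k≤l)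

  -- The chain extended by ∅ below and the whole vertex set above, indexed by size.
  prefix : ℕ → Subset (suc m)
  prefix zero = ⊥
  prefix (suc j) with j <? m
  ... | yes j<m = S (fromℕ< j<m)
  ... | no  _   = ⊤

  ∈prefix⇔ : ∀ {v} j → v ∈ₛ prefix j ⇔ toℕ (rank v) ℕ.< j
  ∈prefix⇔ zero = mk⇔ (λ v∈⊥ → contradiction v∈⊥ ∉⊥) (λ ())
  ∈prefix⇔ {v} (suc j) with j <? m
  ... | yes j<m = subst (λ t → v ∈ₛ S (fromℕ< j<m) ⇔ suc (toℕ (rank v)) ℕ.≤ suc t) (toℕ-fromℕ< j<m)
                        (s≤s⇔ ⇔-∘ ∈⇔rank≤ (fromℕ< j<m))
  ... | no  j≮m = mk⇔ (λ _ → ℕ.≤-trans (toℕ<n (rank v)) (s≤s (ℕ.≮⇒≥ j≮m))) (λ _ → ∈⊤)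

  ∣prefix∣ : ∀ j → j ℕ.≤ suc m → ∣ prefix j ∣ ≡ j
  ∣prefix∣ zero    _ = ∣⊥∣≡0 (suc m)
  ∣prefix∣ (suc j) j≤m with j <? m
  ... | yes j<m = trans (∣S∣ _) (cong suc (toℕ-fromℕ< j<m))
  ... | no  j≮m = trans (∣⊤∣≡n (suc m)) (cong suc (ℕ.≤-antisym (ℕ.≮⇒≥ j≮m) (s≤s⁻¹ j≤m)))

  -- Two vertices of equal rank r would both lie in prefix (suc r) but not in prefix r.
  rank-injective : Injective _≡_ _≡_ rank
  rank-injective {u} {v} ru≡rv with u ≟ v
  ... | yes u≡v = u≡v
  ... | no  u≢v = ⊥-elim (ℕ.1+n≰n (subst₂ (λ a b → 2 ℕ.+ a ℕ.≤ b) ∣A∣≡r ∣B∣≡1+r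
                    (2+∣p∣≤∣q∣ A⊆B (∈B refl) (∈B ru≡rv) (∉A refl) (∉A ru≡rv) u≢v)))
    where
    r = toℕ (rank u)
    A = prefix r
    B = prefix (suc r)
    ∣A∣≡r : ∣ A ∣ ≡ r
    ∣A∣≡r = ∣prefix∣ r (ℕ.<⇒≤ (toℕ<n (rank u)))
    ∣B∣≡1+r : ∣ B ∣ ≡ suc r
    ∣B∣≡1+r = ∣prefix∣ (suc r) (toℕ<n (rank u))
    A⊆B : A ⊆ₛ B
    A⊆B = Equivalence.from (∈prefix⇔ (suc r)) ∘ ℕ.m<n⇒m<1+n ∘ Equivalence.to (∈prefix⇔ r)
    ∈B : ∀ {w} → rank u ≡ rank w → w ∈ₛ B
    ∈B ru≡rw = Equivalence.from (∈prefix⇔ (suc r)) (s≤s (ℕ.≤-reflexive (cong toℕ (sym ru≡rw))))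
    ∉A : ∀ {w} → rank u ≡ rank w → w ∉ₛ A
    ∉A ru≡rw = ℕ.n≮n r ∘ subst (ℕ._< r) (cong toℕ (sym ru≡rw)) ∘ Equivalence.to (∈prefix⇔ r)

module _ {n : ℕ} (K : SimpleGraph n) where

  open import Data.List.Membership.DecPropositional (_≟_ {n}) using (_∈?_)

  adj-sym : ∀ {x y} → Adj K x y → Adj K y x
  adj-sym {x} {y} = trans (SimpleGraph.sym K y x)

  end₁ end₂ : Edge K → Fin n
  end₁ = proj₁ ∘ proj₁
  end₂ = proj₂ ∘ proj₁

  -- InDelta K S is Separates (_∈ₛ S).
  Separates : (Fin n → Set) → Edge K → Set
  Separates P e = ExactlyOne (P (end₁ e)) (P (end₂ e))

  data Joins (e : Edge K) (x y : Fin n) : Set where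
    forward  : proj₁ e ≡ (x , y) → Joins e x y
    backward : proj₁ e ≡ (y , x) → Joins e x y

  edge-≡ : ∀ {d e : Edge K} → proj₁ d ≡ proj₁ e → d ≡ e
  edge-≡ {_ , u<v , a} {_ , u<v′ , a′} refl
    rewrite <-irrelevant u<v u<v′ | Decidable⇒UIP.≡-irrelevant Bool._≟_ a a′ = refl

  joins-adj : ∀ {e x y} → Joins e x y → Adj K x y
  joins-adj {_ , _ , a} (forward  refl) = a
  joins-adj {_ , _ , a} (backward refl) = adj-sym a

  joins-separates : ∀ {e x y} {P : Fin n → Set} → Joins e x y → ExactlyOne (P x) (P y) →
                    Separates P e
  joins-separates (forward  refl) = id
  joins-separates (backward refl) = ExactlyOne-sym

  joins-unique : ∀ {d e x y} → Joins d x y → Joins e x y → d ≡ e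
  joins-unique (forward  d≡xy) (forward  e≡xy) = edge-≡ (trans d≡xy (sym e≡xy))
  joins-unique (backward d≡yx) (backward e≡yx) = edge-≡ (trans d≡yx (sym e≡yx))
  joins-unique {_ , x<y , _} {_ , y<x , _} (forward  refl) (backward refl) = ⊥-elim (<-asym x<y y<x)
  joins-unique {_ , y<x , _} {_ , x<y , _} (backward refl) (forward  refl) = ⊥-elim (<-asym x<y y<x)

  edgeBetween : ∀ {x y} → Adj K x y → Σ[ e ∈ Edge K ] Joins e x y
  edgeBetween {x} {y} x~y with <-cmp x y
  ... | tri< x<y _ _  = (_ , x<y , x~y) , forward refl
  ... | tri≈ _ refl _ = contradiction x~y (SimpleGraph.irrefl K x)
  ... | tri> _ _ y<x  = (_ , y<x , adj-sym x~y) , backward refl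

  data Subtree : ℕ → List (Fin n) → List (Edge K) → Set where
    root   : ∀ r → Subtree 0 [ r ] []
    attach : ∀ {k V E x y e} → Subtree k V E → x ∉ V → y ∈ V → Joins e x y →
             Subtree (suc k) (x ∷ V) (e ∷ E)

  vertices-unique : ∀ {k V E} → Subtree k V E → Unique V
  vertices-unique (root r)          = [] ∷ []
  vertices-unique (attach T x∉ _ _) = ¬Any⇒All¬ _ x∉ ∷ vertices-unique T

  vertices-length : ∀ {k V E} → Subtree k V E → length V ≡ suc k
  vertices-length (root r)         = refl
  vertices-length (attach T _ _ _) = cong suc (vertices-length T)

  endpoints-within : ∀ {k V E d} → Subtree k V E → d ∈ E → end₁ d ∈ V × end₂ d ∈ V
  endpoints-within (attach T _ y∈ (forward  refl)) (here refl) = here refl , there y∈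
  endpoints-within (attach T _ y∈ (backward refl)) (here refl) = there y∈ , here refl
  endpoints-within (attach T _ _  _)               (there d∈)  =
    Product.map there there (endpoints-within T d∈)

  attached-edge-new : ∀ {k V E x y e} → Subtree k V E → x ∉ V → Joins e x y → e ∉ E
  attached-edge-new T x∉ (forward  refl) = x∉ ∘ proj₁ ∘ endpoints-within T
  attached-edge-new T x∉ (backward refl) = x∉ ∘ proj₂ ∘ endpoints-within T

  record SubtreeContaining (V : List (Fin n)) : Set where
    constructor containing
    field
      {size}     : ℕ
      {vertices} : List (Fin n)
      {edges}    : List (Edge K)
      subtree    : Subtree size vertices edges
      ⊇V         : V ⊆ vertices

  open SubtreeContaining using (vertices)

  extendAlong : ∀ {k V E u w} → Subtree k V E → u ∈ V → Walk K u w →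
                Σ[ X ∈ SubtreeContaining V ] w ∈ vertices X
  extendAlong T u∈ here = containing T id , u∈
  extendAlong {V = V} T u∈ (step {w = t} u~t t⇝w) with t ∈? V
  ... | yes t∈ = extendAlong T t∈ t⇝w
  ... | no  t∉ with extendAlong (attach T t∉ u∈ (proj₂ (edgeBetween (adj-sym u~t)))) (here refl) t⇝w
  ...   | containing T′ ⊇ , w∈ = containing T′ (⊇ ∘ there) , w∈

  extendOver : Connected K → ∀ ws {k V E r} → Subtree k V E → r ∈ V →
               Σ[ X ∈ SubtreeContaining V ] ws ⊆ vertices X
  extendOver _         []       T r∈ = containing T id , λ ()
  extendOver connected (w ∷ ws) {r = r} T r∈ with extendAlong T r∈ (connected r w)
  ... | containing T′ ⊇ , w∈ with extendOver connected ws T′ (⊇ r∈)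
  ...   | containing T″ ⊇′ , ws⊆ =
    containing T″ (⊇′ ∘ ⊇) , λ { (here refl) → ⊇′ w∈ ; (there w∈ws) → ws⊆ w∈ws }

  spanning-subtree : Connected K → Fin n → ∃₂ λ V E → Subtree (n ∸ 1) V E × (∀ v → v ∈ V)
  spanning-subtree connected r with extendOver connected (allFin n) (root r) (here refl)
  ... | containing T _ , all⊆ with all∈V ← all⊆ ∘ ∈-allFin
    with cong ℕ.pred (trans (sym (vertices-length T))
                            (enumeration-length (vertices-unique T) all∈V))
  ... | refl = _ , _ , T , all∈V

  -- Tree paths, and why a tree has no other edges

  record Path (V : List (Fin n)) (u w : Fin n) : Set where
    field
      rest   : List (Fin n)
      unique : Unique (u ∷ rest)
      linked : Linked (Adj K) (u ∷ rest)
      within : All (_∈ V) (u ∷ rest)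
      ends   : last (u ∷ rest) ≡ just w

  stay : ∀ {V u} → u ∈ V → Path V u u
  stay u∈ = record { rest = [] ; unique = [] ∷ [] ; linked = [-] ; within = u∈ ∷ [] ; ends = refl }

  widen : ∀ {V u w x} → Path V u w → Path (x ∷ V) u w
  widen P = record { Path P ; within = All.map there (Path.within P) }

  prepend : ∀ {V x y w} → x ∉ V → Adj K x y → Path V y w → Path (x ∷ V) x w
  prepend x∉ x~y P = record
    { rest   = _ ∷ rest
    ; unique = ¬Any⇒All¬ _ (∉-within x∉ within) ∷ unique
    ; linked = x~y ∷ linked
    ; within = here refl ∷ All.map there within
    ; ends   = ends
    }
    where open Path P

  append : ∀ {V x y u} → x ∉ V → Adj K y x → Path V u y → Path (x ∷ V) u x
  append {x = x} {u = u} x∉ y~x P = record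
    { rest   = rest ∷ʳ x
    ; unique = unique-∷ʳ unique (∉-within x∉ within)
    ; linked = linked-∷ʳ linked ends y~x
    ; within = ∷ʳ⁺ (All.map there within) (here refl)
    ; ends   = last-∷ʳ (u ∷ rest) x
    }
    where open Path P

  path : ∀ {k V E u w} → Subtree k V E → u ∈ V → w ∈ V → Path V u w
  path (root r)             (here refl) (here refl) = stay (here refl)
  path (attach T x∉ y∈ x~y) (here refl) (here refl) = stay (here refl)
  path (attach T x∉ y∈ x~y) (here refl) (there w∈)  = prepend x∉ (joins-adj x~y) (path T y∈ w∈)
  path (attach T x∉ y∈ x~y) (there u∈)  (here refl) =
    append x∉ (adj-sym (joins-adj x~y)) (path T u∈ y∈)
  path (attach T x∉ y∈ x~y) (there u∈)  (there w∈)  = widen (path T u∈ w∈)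

  cycle : ∀ {V x y z} → x ∉ V → Adj K x y → Path V y z → Adj K z x → y ≢ z → HasCycle K
  cycle x∉ x~y record { rest = [] ; ends = refl } z~x y≢z = contradiction refl y≢z
  cycle {x = x} {y} x∉ x~y P@record { rest = p ∷ ps } z~x _ =
    x , y ∷ p ∷ ps , s≤s (s≤s z≤n) , ¬Any⇒All¬ _ (∉-within x∉ within) ∷ unique ,
    x~y ∷ linked-∷ʳ linked ends z~x
    where open Path P

  pendant : ∀ {k V E x y z d e} → Subtree k V E → x ∉ V → y ∈ V → Joins e x y → Joins d x z →
            z ∈ V → d ∈ e ∷ E ⊎ HasCycle K
  pendant {y = y} {z} T x∉ y∈ x~y x~z z∈ with y ≟ z
  ... | yes refl = inj₁ (here (joins-unique x~z x~y))
  ... | no  y≢z  = inj₂ (cycle x∉ (joins-adj x~y) (path T y∈ z∈) (adj-sym (joins-adj x~z)) y≢z)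

  complete : ∀ {k V E} → Subtree k V E → ∀ d → end₁ d ∈ V → end₂ d ∈ V → d ∈ E ⊎ HasCycle K
  complete (root r)         (_ , u<v , _) (here refl) (here refl) = ⊥-elim (<-irrefl refl u<v)
  complete (attach T _ _ _) (_ , u<v , _) (here refl) (here refl) = ⊥-elim (<-irrefl refl u<v)
  complete (attach T x∉ y∈ x~y) d (here refl) (there v∈)  = pendant T x∉ y∈ x~y (forward refl) v∈
  complete (attach T x∉ y∈ x~y) d (there u∈)  (here refl) = pendant T x∉ y∈ x~y (backward refl) u∈
  complete (attach T _ _ _)     d (there u∈)  (there v∈)  = Sum.map₁ there (complete T d u∈ v∈)

  -- Matching cuts with edges

  record CutMatching {k} (C : Fin k → Fin n → Set) (E : List (Edge K)) : Set where
    field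
      edge           : Fin k → Edge K
      edge∈          : ∀ i → edge i ∈ E
      edge-injective : Injective _≡_ _≡_ edge
      edge-onto      : ∀ {d} → d ∈ E → ∃ λ i → edge i ≡ d
      separates      : ∀ i → Separates (C i) (edge i)

  CutMatching-resp : ∀ {k E} {C D : Fin k → Fin n → Set} → (∀ i v → C i v ⇔ D i v) →
                     CutMatching C E → CutMatching D E
  CutMatching-resp C⇔D M = record
    { CutMatching M
    ; separates = λ i → ExactlyOne-resp (C⇔D i _) (C⇔D i _) (CutMatching.separates M i)
    }

  insertCut : ∀ {k E e} {C : Fin (suc k) → Fin n → Set} (q : Fin (suc k)) → e ∉ E →
              Separates (C q) e → CutMatching (C ∘ punchIn q) E → CutMatching C (e ∷ E)
  insertCut {k} {E} {e} {C} q e∉E e-separates M = record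
    { edge = edge ; edge∈ = edge∈ ; edge-injective = edge-injective ; edge-onto = edge-onto
    ; separates = separates
    }
    where
    module M = CutMatching M

    edge : Fin (suc k) → Edge K
    edge i with q ≟ i
    ... | yes _   = e
    ... | no  q≢i = M.edge (punchOut q≢i)

    edge-q : edge q ≡ e
    edge-q with q ≟ q
    ... | yes _   = refl
    ... | no  q≢q = contradiction refl q≢q

    edge-punchIn : ∀ j → edge (punchIn q j) ≡ M.edge j
    edge-punchIn j with q ≟ punchIn q j
    ... | yes q≡ = contradiction (sym q≡) (punchInᵢ≢i q j)
    ... | no  _  = cong M.edge (trans (punchOut-cong q refl) (punchOut-punchIn q))

    edge∈ : ∀ i → edge i ∈ e ∷ E
    edge∈ i with q ≟ i
    ... | yes _ = here refl
    ... | no  _ = there (M.edge∈ _)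

    edge-injective : Injective _≡_ _≡_ edge
    edge-injective {i} {j} eq with q ≟ i | q ≟ j
    ... | yes refl | yes refl = refl
    ... | yes refl | no  _    = contradiction (subst (_∈ E) (sym eq) (M.edge∈ _)) e∉E
    ... | no  _    | yes refl = contradiction (subst (_∈ E) eq (M.edge∈ _)) e∉E
    ... | no  q≢i  | no  q≢j  = punchOut-injective q≢i q≢j (M.edge-injective eq)

    edge-onto : ∀ {d} → d ∈ e ∷ E → ∃ λ i → edge i ≡ d
    edge-onto (here refl) = q , edge-q
    edge-onto (there d∈) with M.edge-onto d∈
    ... | j , refl = punchIn q j , edge-punchIn j

    separates : ∀ i → Separates (C i) (edge i)
    separates i with q ≟ i
    ... | yes refl = e-separates
    ... | no  q≢i  = subst (λ i → Separates (C i) (M.edge (punchOut q≢i)))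
                           (punchIn-punchOut q≢i) (M.separates (punchOut q≢i))

  Cut : ∀ {k} → (Fin n → Fin (suc k)) → Fin k → Fin n → Set
  Cut rank i v = rank v ≤ i

  InjectiveOn : ∀ {B : Set} → (Fin n → B) → List (Fin n) → Set
  InjectiveOn f V = ∀ {u v} → u ∈ V → v ∈ V → f u ≡ f v → u ≡ v

  injectiveOn-fresh : ∀ {B : Set} {f : Fin n → B} {x V v} → InjectiveOn f (x ∷ V) → x ∉ V →
                      v ∈ V → f x ≢ f v
  injectiveOn-fresh {V = V} f-inj x∉ v∈ fx≡fv =
    x∉ (subst (_∈ V) (sym (f-inj (here refl) (there v∈) fx≡fv)) v∈)

  -- Pinching at q closes up the gap left by the leaf x, since rank x is a side of q; the cuts of
  -- the smaller tree then correspond to the cuts other than q.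
  cutMatching : ∀ {k V E} → Subtree k V E → (rank : Fin n → Fin (suc k)) → InjectiveOn rank V →
                CutMatching (Cut rank) E
  cutMatching (root r) rank _ = record
    { edge = λ () ; edge∈ = λ () ; edge-injective = λ {} ; edge-onto = λ () ; separates = λ () }
  cutMatching {V = x ∷ V} (attach T x∉ y∈ x~y) rank rank-inj
    with cutNextTo (rank x) (rank _) (injectiveOn-fresh rank-inj x∉ y∈)
  ... | q , side , x|y =
    insertCut q (attached-edge-new T x∉ x~y) (joins-separates x~y x|y)
      (CutMatching-resp (λ j v → pinch≤⇔≤punchIn q (rank v) j)
        (cutMatching T (pinch q ∘ rank) pinched-injective))
    where
    pinched-injective : InjectiveOn (pinch q ∘ rank) V
    pinched-injective u∈ v∈ =
      rank-inj (there u∈) (there v∈)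
      ∘ pinch-injective-avoiding side (injectiveOn-fresh rank-inj x∉ u∈)
                                      (injectiveOn-fresh rank-inj x∉ v∈)

lemma8 : (n : ℕ) (K : SimpleGraph n) → IsTree K →
    (S : Fin (n ∸ 1) → Subset n) →
    (∀ k → ∣ S k ∣ ≡ suc (toℕ k)) →
    (∀ k l → toℕ l ≡ suc (toℕ k) → S k ⊂ S l) →
    ∃[ f ] (Bijective _≡_ _≡_ f × (∀ k → InDelta K (S k) (f k)))
lemma8 zero    K _ S _ _ = (λ ()) , ((λ {}) , λ { ((() , _) , _) }) , λ ()
lemma8 (suc m) K (connected , acyclic) S ∣S∣ S⊂S with spanning-subtree K connected zero
... | V , E , T , all∈V =
  edge , (edge-injective , strictlySurjective⇒surjective (edge-onto ∘ all∈E)) , separates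
  where
  open Chain S ∣S∣ (λ k l → proj₁ ∘ S⊂S k l)
  open CutMatching (CutMatching-resp K (λ i v → ⇔-sym (∈⇔rank≤ i))
                                      (cutMatching K T rank (λ _ _ → rank-injective)))
  all∈E : ∀ d → d ∈ E
  all∈E d = [ id , ⊥-elim ∘ acyclic ]′ (complete K T d (all∈V _) (all∈V _))
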